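{- Let $A\in\{1,\ldots,n\}^k$ and $B\subset\{1,\ldots,n\}$ with $|B|=k+1$. Let $\tilde A=c^{1-\rho(A,B)}A$, $\tilde B=c^{1-\rho(A,B)}B$, let $I=(i_1\leq\cdots\leq i_k)$ be the non-decreasing rearrangement of $\tilde A$, and let $(j_1,\ldots,j_k)=\Pi(I,\tilde B)$. Then $i_l<j_l$ for all $l\in\{1,\ldots,k\}$.
   Context: $c=(1\,2\,\cdots\,n)$, i.e. $c(x)=x+1$ for $x<n$ and $c(n)=1$; $c$ acts on sequences coordinatewise and on subsets elementwise. Parking process: for $E=(e_1,\ldots,e_k)\in\{1,\ldots,n\}^k$ and $O\subset\{1,\ldots,n\}$ with $|O|=k+1$, define $p_k,\ldots,p_1$ backwards by $p_l=c^{r}(e_l)$ where $r$ is the least $s\in\{1,\ldots,n\}$ such that $c^s(e_l)\in O\setminus\{p_{l+1},\ldots,p_k\}$. Set $\Pi(E,O)=(p_1,\ldots,p_k)$; the residue $\rho(E,O)$ is the unique element of $O\setminus\{p_1,\ldots,p_k\}$. -}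

module Defs where

open import Data.Nat as ℕ using (ℕ; zero; suc; _∸_)
open import Data.Fin using (Fin; zero; suc; toℕ; lower₁)
open import Data.Fin.Subset using (Subset; _-_; outside; inside)
open import Data.Bool using (Bool; true; false; if_then_else_)
open import Data.List using (List; []; _∷_; map; upTo)
open import Data.Vec using (Vec; []; _∷_; lookup; tabulate)
open import Data.Vec.Membership.Propositional using (_∈_)
open import Data.Product using (_×_; _,_)
open import Data.Maybe using (Maybe; just; nothing; fromMaybe)
open import Function using (_∘_)
open import Relation.Nullary using (yes; no; ¬_)

-- Convention: an element x : Fin n represents the integer toℕ x + 1 ∈ {1,…,n}.
-- This shift preserves the order, so i < j in Fin n agrees with the paper's order.

-- The long cycle c = (1 2 ⋯ n): c(x) = x+1 for x < n, c(n) = 1.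
c : ∀ {n} → Fin n → Fin n
c {suc m} x with m ℕ.≟ toℕ x
... | yes _  = zero
... | no ne  = suc (lower₁ x ne)

cpow : ∀ {n} → ℕ → Fin n → Fin n
cpow zero    x = x
cpow (suc s) x = c (cpow s x)

cpowSeq : ∀ {n k} → ℕ → Vec (Fin n) k → Vec (Fin n) k
cpowSeq s = Data.Vec.map (cpow s)

anyL : ∀ {n} → (Fin n → Bool) → List (Fin n) → Bool
anyL p []       = false
anyL p (x ∷ xs) = if p x then true else anyL p xs

allFinL : ∀ n → List (Fin n)
allFinL zero    = []
allFinL (suc n) = zero ∷ map suc (allFinL n)

eqB : ∀ {n} → Fin n → Fin n → Bool
eqB x y with x Data.Fin.≟ y
... | yes _ = true
... | no  _ = false

cpowSet : ∀ {n} → ℕ → Subset n → Subset n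
cpowSet {n} s O = tabulate λ y → anyL (λ x → if lookup O x then eqB (cpow s x) y else false) (allFinL n)

firstIn : ∀ {n} → List (Fin n) → Subset n → Maybe (Fin n)
firstIn []       O = nothing
firstIn (x ∷ xs) O = if lookup O x then just x else firstIn xs O

-- c^r(e) for the least r ∈ {1,…,n} with c^r(e) ∈ O
-- (the default e is never used when O is nonempty)
nextFree : ∀ {n} → Fin n → Subset n → Fin n
nextFree {n} e O = fromMaybe e (firstIn (map (λ s → cpow s e) (map suc (upTo n))) O)

-- Parking process, processing e_k, e_{k-1}, …, e_1 in turn; returns
-- (p_1,…,p_k) together with the set of still-unoccupied spots.
park : ∀ {n k} → Vec (Fin n) k → Subset n → Vec (Fin n) k × Subset n
park []       O = [] , O
park (e ∷ es) O with park es O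
... | ps , O' = let p = nextFree e O' in (p ∷ ps) , (O' - p)

Π : ∀ {n k} → Vec (Fin n) k → Subset n → Vec (Fin n) k
Π E O = Data.Product.proj₁ (park E O)

-- r is a residue of (E,O): r ∈ O ∖ {p_1,…,p_k}  (this element is unique when |O| = k+1)
IsResidue : ∀ {n k} → Vec (Fin n) k → Subset n → Fin n → Set
IsResidue E O r = (r Data.Fin.Subset.∈ O) × ¬ (r ∈ Π E O)

-- exponent representing 1 - ρ modulo n (ρ = toℕ r + 1, and c^n = id):
-- c^{1-ρ} = c^{-toℕ r} = c^{n ∸ toℕ r}
expOneMinus : ∀ {n} → Fin n → ℕ
expOneMinus {n} r = n ∸ toℕ r

module Submission where

-- The proof does not use that I is sorted, nor that |B| = k+1; it rests on three
-- facts about the set of spots left free by the parking process.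
--  * Order independence: one parking step (a car preferring e takes the first
--    free spot on the cyclic walk e+1, e+2, …) commutes with another one, so the
--    final free set only depends on the multiset of preferences.
--  * Rotation equivariance: rotating all preferences and spots by c^s rotates the
--    free set by c^s.
--  * No wrap-around: if spot 1 is still free at the end, no car ever passed
--    from n to 1, so every car parks strictly after its preference.
-- The residue ρ is free after parking A into B, hence 1 = c^{1-ρ}(ρ) is free after
-- parking Ã into B̃, hence (order independence) after parking I into B̃, and the
-- third fact gives the claim.

open import Defs
open import Data.Nat using (ℕ; suc)
open import Data.Fin using (Fin; _<_)
open import Data.Fin.Subset using (Subset; ∣_∣)
open import Data.Fin.Properties using (≤-totalOrder)
open import Data.Vec using (Vec; lookup; toList)
open import Data.List.Relation.Unary.Sorted.TotalOrder using (Sorted)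
open import Data.List.Relation.Binary.Permutation.Propositional using (_↭_)
open import Data.List.Relation.Binary.Permutation.Propositional as ↭ using (prep; swap)
open import Relation.Binary.PropositionalEquality using (_≡_)

open import Data.Nat as ℕ using (zero; _+_; _∸_; z<s; s<s)
open import Data.Nat.Properties as ℕ
  using (+-comm; +-suc; +-identityʳ; +-∸-assoc; m+[n∸m]≡n; m∸n+n≡m; m<m+n; <-cmp; +-monoʳ-≤)
open import Data.Fin as Fin using (zero; suc; toℕ)
open import Data.Fin.Properties as Fin using (toℕ≤n; toℕ-injective; toℕ-lower₁; toℕ<n; toℕ≤pred[n])
open import Data.Bool using (Bool; true; false; if_then_else_)
open import Data.List.Relation.Unary.Any as ListAny using ()
open import Data.List.Membership.Propositional using () renaming (_∈_ to _∈ₗ_)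
open import Data.List.Membership.Propositional.Properties using (∈-map⁺)
open import Data.List using (List; []; _∷_; _++_; map; applyUpTo; upTo)
open import Data.List.Properties using (map-cong; map-upTo; map-applyUpTo; applyUpTo-∷ʳ)
open import Data.List.Relation.Unary.All as All using (All; []; _∷_)
open import Data.List.Relation.Unary.All.Properties using (∷ʳ⁺; applyUpTo⁻)
open import Data.Maybe as Maybe using (Maybe; just; nothing; fromMaybe)
open import Data.Maybe.Properties using (just-injective)
open import Data.Vec using ([]; _∷_; there)
open import Data.Vec.Properties using ([]=⇒lookup; lookup⇒[]=; lookup∘tabulate; toList-map)
open import Data.Vec.Relation.Unary.Any as VecAny using ()
open import Data.Vec.Membership.Propositional using () renaming (_∈_ to _∈ᵥ_)
open import Data.Fin.Subset using (_∈_; _∉_; _⊆_; _-_; _─_; ⁅_⁆)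
open import Data.Fin.Subset.Properties using (p─q─r≡p─r─q; ⊆-antisym; p─q⊆p; x∈p∧x∉q⇒x∈p─q; x∈⁅x⁆; x≢y⇒x∉⁅y⁆)
open import Data.Product using (_×_; _,_; proj₁; proj₂; ∃)
open import Function using (_∘_)
open import Relation.Binary.Definitions using (tri<; tri≈; tri>)
open import Relation.Nullary using (yes; no; ¬_; contradiction)
open import Relation.Binary.PropositionalEquality
  using (_≢_; refl; sym; trans; cong; subst; module ≡-Reasoning)

-- Arithmetic of the cycle c on Fin (suc m); toℕ x is the paper's x − 1.

c-last : ∀ {m} (x : Fin (suc m)) → toℕ x ≡ m → c x ≡ zero
c-last {m} x x≡m with m ℕ.≟ toℕ x
... | yes _   = refl
... | no m≢x  = contradiction (sym x≡m) m≢x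

c-step : ∀ {m} (x : Fin (suc m)) → toℕ x ≢ m → toℕ (c x) ≡ suc (toℕ x)
c-step {m} x x≢m with m ℕ.≟ toℕ x
... | yes m≡x = contradiction (sym m≡x) x≢m
... | no m≢x  = cong suc (toℕ-lower₁ x m≢x)

cpow-+ : ∀ {n} a b (x : Fin n) → cpow a (cpow b x) ≡ cpow (a + b) x
cpow-+ zero    b x = refl
cpow-+ (suc a) b x = cong c (cpow-+ a b x)

cpow-comm : ∀ {n} a b (x : Fin n) → cpow a (cpow b x) ≡ cpow b (cpow a x)
cpow-comm a b x = trans (cpow-+ a b x) (trans (cong (λ e → cpow e x) (+-comm a b)) (sym (cpow-+ b a x)))

toℕ-cpow : ∀ {m} k (x : Fin (suc m)) → toℕ x + k ℕ.< suc m → toℕ (cpow k x) ≡ toℕ x + k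
toℕ-cpow zero    x _ = sym (+-identityʳ (toℕ x))
toℕ-cpow {m} (suc k) x x+1+k<n = begin
  toℕ (c (cpow k x))   ≡⟨ c-step (cpow k x) (ℕ.<⇒≢ (subst (ℕ._< m) (sym ih) x+k<m)) ⟩
  suc (toℕ (cpow k x)) ≡⟨ cong suc ih ⟩
  suc (toℕ x + k)      ≡⟨ sym (+-suc (toℕ x) k) ⟩
  toℕ x + suc k        ∎
  where
  open ≡-Reasoning
  x+k<m : toℕ x + k ℕ.< m
  x+k<m = subst (ℕ._≤ m) (+-suc (toℕ x) k) (ℕ.≤-pred x+1+k<n)
  ih : toℕ (cpow k x) ≡ toℕ x + k
  ih = toℕ-cpow k x (ℕ.m<n⇒m<1+n x+k<m)

cpow-wrap : ∀ {m} (x : Fin (suc m)) → cpow (suc (m ∸ toℕ x)) x ≡ zero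
cpow-wrap {m} x = c-last (cpow (m ∸ toℕ x) x)
  (trans (toℕ-cpow (m ∸ toℕ x) x (s<s (ℕ.≤-reflexive x+[m∸x]≡m))) x+[m∸x]≡m)
  where
  x+[m∸x]≡m : toℕ x + (m ∸ toℕ x) ≡ m
  x+[m∸x]≡m = m+[n∸m]≡n (toℕ≤pred[n] x)

cpow-from-zero : ∀ {m} (y : Fin (suc m)) → cpow (toℕ y) zero ≡ y
cpow-from-zero y = toℕ-injective (toℕ-cpow (toℕ y) zero (toℕ<n y))

cpow-period : ∀ {m} (x : Fin (suc m)) → cpow (suc m) x ≡ x
cpow-period {m} x = begin
  cpow (suc m) x                             ≡⟨ cong (λ e → cpow e x) (sym t+[n∸t]≡n) ⟩
  cpow (toℕ x + suc (m ∸ toℕ x)) x           ≡⟨ sym (cpow-+ (toℕ x) _ x) ⟩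
  cpow (toℕ x) (cpow (suc (m ∸ toℕ x)) x)    ≡⟨ cong (cpow (toℕ x)) (cpow-wrap x) ⟩
  cpow (toℕ x) zero                          ≡⟨ cpow-from-zero x ⟩
  x                                          ∎
  where
  open ≡-Reasoning
  t+[n∸t]≡n : toℕ x + suc (m ∸ toℕ x) ≡ suc m
  t+[n∸t]≡n = trans (+-suc (toℕ x) _) (cong suc (m+[n∸m]≡n (toℕ≤pred[n] x)))

cpow-inverse : ∀ {m} a b → a + b ≡ suc m → (x : Fin (suc m)) → cpow a (cpow b x) ≡ x
cpow-inverse a b a+b≡n x = trans (cpow-+ a b x) (trans (cong (λ e → cpow e x) a+b≡n) (cpow-period x))

lookup-true⇒∈ : ∀ {n} {O : Subset n} {x} → lookup O x ≡ true → x ∈ O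
lookup-true⇒∈ {O = O} {x} hit = lookup⇒[]= x O hit

lookup-false⇒∉ : ∀ {n} {O : Subset n} {x} → lookup O x ≡ false → x ∉ O
lookup-false⇒∉ miss x∈O with () ← trans (sym ([]=⇒lookup x∈O)) miss

∈-─⇒∉ : ∀ {n} (p q : Subset n) {x} → x ∈ p ─ q → x ∉ q
∈-─⇒∉ (_ ∷ p) (_ ∷ q) (there x∈p─q) (there x∈q) = ∈-─⇒∉ p q x∈p─q x∈q

∈-minus⁺ : ∀ {n} {O : Subset n} {x y} → y ∈ O → y ≢ x → y ∈ O - x
∈-minus⁺ y∈O y≢x = x∈p∧x∉q⇒x∈p─q y∈O (x≢y⇒x∉⁅y⁆ y≢x)

∈-minus⁻ : ∀ {n} {O : Subset n} {x y} → y ∈ O - x → y ∈ O × y ≢ x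
∈-minus⁻ {O = O} {x} y∈O-x =
  p─q⊆p O ⁅ x ⁆ y∈O-x , λ { refl → ∈-─⇒∉ O ⁅ x ⁆ y∈O-x (x∈⁅x⁆ x) }

minus-∉ : ∀ {n} {O : Subset n} {x} → x ∉ O → O - x ≡ O
minus-∉ {O = O} {x} x∉O = ⊆-antisym (p─q⊆p O ⁅ x ⁆)
  (λ y∈O → ∈-minus⁺ y∈O (λ { refl → x∉O y∈O }))

firstIn-∈ : ∀ {n} {O : Subset n} {x} xs → x ∈ O → firstIn (x ∷ xs) O ≡ just x
firstIn-∈ _ x∈O rewrite []=⇒lookup x∈O = refl

firstIn-∉ : ∀ {n} {O : Subset n} {x} xs → x ∉ O → firstIn (x ∷ xs) O ≡ firstIn xs O
firstIn-∉ {O = O} {x} _ x∉O with lookup O x in hit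
... | true  = contradiction (lookup-true⇒∈ hit) x∉O
... | false = refl

firstIn-found : ∀ {n} {O : Subset n} xs {q} → firstIn xs O ≡ just q → q ∈ O
firstIn-found {O = O} (x ∷ xs) found with lookup O x in hit
... | true  = subst (_∈ O) (just-injective found) (lookup-true⇒∈ hit)
... | false = firstIn-found xs found

firstIn-none : ∀ {n} {O : Subset n} xs → firstIn xs O ≡ nothing → All (_∉ O) xs
firstIn-none []       _ = []
firstIn-none {O = O} (x ∷ xs) none with lookup O x in hit
... | false = lookup-false⇒∉ hit ∷ firstIn-none xs none

firstIn-outside : ∀ {n} {O : Subset n} {xs} → All (_∉ O) xs → firstIn xs O ≡ nothing
firstIn-outside []                    = refl
firstIn-outside {xs = _ ∷ xs} (x∉O ∷ rest) = trans (firstIn-∉ xs x∉O) (firstIn-outside rest)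

firstIn-skip : ∀ {n} {O : Subset n} {P} R → All (_∉ O) P → firstIn (P ++ R) O ≡ firstIn R O
firstIn-skip R []                         = refl
firstIn-skip {P = _ ∷ P} R (x∉O ∷ rest) = trans (firstIn-∉ (P ++ R) x∉O) (firstIn-skip R rest)

firstIn-skip-end : ∀ {n} {O : Subset n} {P} R → All (_∉ O) P → firstIn (R ++ P) O ≡ firstIn R O
firstIn-skip-end []       outside = firstIn-outside outside
firstIn-skip-end {O = O} (x ∷ R) outside with lookup O x
... | true  = refl
... | false = firstIn-skip-end R outside

firstIn-rotate : ∀ {n} {O : Subset n} {P} R → All (_∉ O) P → firstIn (P ++ R) O ≡ firstIn (R ++ P) O
firstIn-rotate R outside = trans (firstIn-skip R outside) (sym (firstIn-skip-end R outside))

firstIn-⊆ : ∀ {n} {O T : Subset n} xs {q} → T ⊆ O → q ∈ T → firstIn xs O ≡ just q → firstIn xs T ≡ just q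
firstIn-⊆ {O = O} (x ∷ xs) T⊆O q∈T found with lookup O x in hit
... | true  with refl ← found = firstIn-∈ xs q∈T
... | false = trans (firstIn-∉ xs (lookup-false⇒∉ hit ∘ T⊆O)) (firstIn-⊆ xs T⊆O q∈T found)

firstIn-map : ∀ {n} {O O' : Subset n} (f : Fin n → Fin n) →
  (∀ {x} → x ∈ O → f x ∈ O') → (∀ {x} → f x ∈ O' → x ∈ O) →
  ∀ xs → firstIn (map f xs) O' ≡ Maybe.map f (firstIn xs O)
firstIn-map f _ _ [] = refl
firstIn-map {O = O} f pres reflect (x ∷ xs) with lookup O x in hit
... | true  = firstIn-∈ (map f xs) (pres (lookup-true⇒∈ hit))
... | false = trans (firstIn-∉ (map f xs) (lookup-false⇒∉ hit ∘ reflect)) (firstIn-map f pres reflect xs)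

firstIn-applyUpTo : ∀ {n} {O : Subset n} (f : ℕ → Fin n) k {q} → firstIn (applyUpTo f k) O ≡ just q →
  ∃ λ d → d ℕ.< k × f d ≡ q × All (_∉ O) (applyUpTo f d)
firstIn-applyUpTo {O = O} f (suc k) found with lookup O (f 0) in hit
... | true  = 0 , z<s , just-injective found , []
... | false with firstIn-applyUpTo (f ∘ suc) k found
...   | d , d<k , fd≡q , outside = suc d , s<s d<k , fd≡q , lookup-false⇒∉ hit ∷ outside

applyUpTo-cong : ∀ {A : Set} {f g : ℕ → A} → (∀ j → f j ≡ g j) → ∀ k → applyUpTo f k ≡ applyUpTo g k
applyUpTo-cong {f = f} {g} f≗g k =
  trans (sym (map-upTo f k)) (trans (map-cong f≗g (upTo k)) (map-upTo g k))

applyUpTo-++ : ∀ {A : Set} (f : ℕ → A) a b → applyUpTo f (a + b) ≡ applyUpTo f a ++ applyUpTo (f ∘ (a +_)) b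
applyUpTo-++ f zero    b = refl
applyUpTo-++ f (suc a) b = cong (f 0 ∷_) (applyUpTo-++ (f ∘ suc) a b)

applyUpTo-rotate : ∀ {A : Set} (f : ℕ → A) N {d} → (∀ j → f (N + j) ≡ f j) → d ℕ.≤ N →
  applyUpTo (f ∘ (d +_)) N ≡ applyUpTo (f ∘ (d +_)) (N ∸ d) ++ applyUpTo f d
applyUpTo-rotate f N {d} periodic d≤N = begin
  applyUpTo (f ∘ (d +_)) N                                      ≡⟨ cong (applyUpTo (f ∘ (d +_))) (sym (m∸n+n≡m d≤N)) ⟩
  applyUpTo (f ∘ (d +_)) (N ∸ d + d)                            ≡⟨ applyUpTo-++ (f ∘ (d +_)) (N ∸ d) d ⟩
  applyUpTo (f ∘ (d +_)) (N ∸ d) ++ applyUpTo (λ j → f (d + (N ∸ d + j))) d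
                                                                ≡⟨ cong (applyUpTo (f ∘ (d +_)) (N ∸ d) ++_) (applyUpTo-cong wrap d) ⟩
  applyUpTo (f ∘ (d +_)) (N ∸ d) ++ applyUpTo f d               ∎
  where
  open ≡-Reasoning
  wrap : ∀ j → f (d + (N ∸ d + j)) ≡ f j
  wrap j = trans (cong f (trans (sym (ℕ.+-assoc d (N ∸ d) j)) (cong (_+ j) (m+[n∸m]≡n d≤N)))) (periodic j)

-- walk e j = c^{j+1} e is the (j+1)-th spot visited by a car preferring e; the
-- orbit e+1, e+2, …, e+n = e is the list of spots it inspects.
walk : ∀ {n} → Fin n → ℕ → Fin n
walk e j = cpow (suc j) e

orbit : ∀ {n} → Fin n → List (Fin n)
orbit {n} e = applyUpTo (walk e) n

first : ∀ {n} → Fin n → Subset n → Maybe (Fin n)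
first e O = firstIn (orbit e) O

nextFree-first : ∀ {n} (e : Fin n) (O : Subset n) → nextFree e O ≡ fromMaybe e (first e O)
nextFree-first {n} e O = cong (λ xs → fromMaybe e (firstIn xs O))
  (trans (cong (map (λ s → cpow s e)) (map-upTo suc n)) (map-applyUpTo suc (λ s → cpow s e) n))

settle : ∀ {n} → Fin n → Subset n → Subset n
settle e O = O - nextFree e O

nextFree-hit : ∀ {n} {e : Fin n} {O q} → first e O ≡ just q → nextFree e O ≡ q
nextFree-hit {e = e} {O} found = trans (nextFree-first e O) (cong (fromMaybe e) found)

settle-hit : ∀ {n} {e : Fin n} {O q} → first e O ≡ just q → settle e O ≡ O - q
settle-hit {O = O} found = cong (O -_) (nextFree-hit found)

walk-shift : ∀ {n} k j (a : Fin n) → walk a (k + j) ≡ walk (cpow k a) j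
walk-shift k j a = trans (cong (λ e → cpow (suc e) a) (+-comm k j)) (sym (cpow-+ (suc j) k a))

-- A car that finds no free spot on its orbit changes nothing; in particular its
-- preference e itself (the end of the orbit) is not free.
settle-idle : ∀ {m} {e : Fin (suc m)} {O} → All (_∉ O) (orbit e) → settle e O ≡ O
settle-idle {m} {e} {O} outside = begin
  O - nextFree e O ≡⟨ cong (O -_) (trans (nextFree-first e O) (cong (fromMaybe e) (firstIn-outside outside))) ⟩
  O - e            ≡⟨ minus-∉ e∉O ⟩
  O                ∎
  where
  open ≡-Reasoning
  e∉O : e ∉ O
  e∉O = subst (_∉ O) (cpow-period e) (applyUpTo⁻ (walk e) (suc m) outside (ℕ.n<1+n m))

settle-cong : ∀ {m} {a b : Fin (suc m)} {T} → first a T ≡ first b T → settle a T ≡ settle b T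
settle-cong {a = a} {b} {T} same with first a T in found-a
... | just r  = trans (settle-hit found-a) (sym (settle-hit (sym same)))
... | nothing = trans (settle-idle (firstIn-none (orbit a) found-a))
                      (sym (settle-idle (firstIn-none (orbit b) (sym same))))

orbit-split : ∀ {m} (a : Fin (suc m)) {d} → d ℕ.< suc m →
  let P = applyUpTo (walk a) (suc d)
      R = applyUpTo (walk a ∘ (suc d +_)) (suc m ∸ suc d)
  in orbit a ≡ P ++ R × orbit (cpow (suc d) a) ≡ R ++ P
orbit-split {m} a {d} d<n =
    trans (cong (applyUpTo (walk a)) (sym (m+[n∸m]≡n {suc d} {suc m} d<n))) (applyUpTo-++ (walk a) (suc d) (suc m ∸ suc d))
  , trans (applyUpTo-cong (λ j → sym (walk-shift (suc d) j a)) (suc m))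
          (applyUpTo-rotate (walk a) (suc m) periodic d<n)
  where
  periodic : ∀ j → walk a (suc m + j) ≡ walk a j
  periodic j = trans (walk-shift (suc m) j a) (cong (cpow (suc j)) (cpow-period a))

first-after-hit : ∀ {m} (a : Fin (suc m)) {S q} → first a S ≡ just q → first a (S - q) ≡ first q (S - q)
first-after-hit {m} a {S} found with firstIn-applyUpTo (walk a) (suc m) found
... | d , d<n , refl , before = begin
  firstIn (orbit a) (S - q)  ≡⟨ cong (λ xs → firstIn xs (S - q)) (proj₁ (orbit-split a d<n)) ⟩
  firstIn (P ++ R) (S - q)   ≡⟨ firstIn-rotate R P-outside ⟩
  firstIn (R ++ P) (S - q)   ≡⟨ cong (λ xs → firstIn xs (S - q)) (sym (proj₂ (orbit-split a d<n))) ⟩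
  firstIn (orbit q) (S - q)  ∎
  where
  open ≡-Reasoning
  q = cpow (suc d) a
  P = applyUpTo (walk a) (suc d)
  R = applyUpTo (walk a ∘ (suc d +_)) (suc m ∸ suc d)
  P-outside : All (_∉ S - q) P
  P-outside = subst (All (_∉ S - q)) (applyUpTo-∷ʳ _ d)
    (∷ʳ⁺ (All.map (_∘ proj₁ ∘ ∈-minus⁻) before) (λ q∈S-q → proj₂ (∈-minus⁻ q∈S-q) refl))

-- Order independence of the parking process.

first-survives : ∀ {n} {x : Fin n} {S q r} → first x S ≡ just q → q ≢ r → first x (S - r) ≡ just q
first-survives {x = x} found q≢r =
  firstIn-⊆ (orbit x) (proj₁ ∘ ∈-minus⁻) (∈-minus⁺ (firstIn-found (orbit x) found) q≢r) found

settle-comm-idle : ∀ {m} (a b : Fin (suc m)) {S} → first a S ≡ nothing →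
  settle a (settle b S) ≡ settle b (settle a S)
settle-comm-idle a b {S} none = trans (settle-idle (All.map (_∘ proj₁ ∘ ∈-minus⁻) outside))
                                      (cong (settle b) (sym (settle-idle outside)))
  where
  outside : All (_∉ S) (orbit a)
  outside = firstIn-none (orbit a) none

-- If one car finds nothing, both sides are the result of
-- the other step; if they find different spots, each still finds its spot after the
-- other parked; if they find the same spot q, both searches then restart from q.
settle-comm : ∀ {m} (a b : Fin (suc m)) S → settle a (settle b S) ≡ settle b (settle a S)
settle-comm a b S with first a S in found-a | first b S in found-b
... | nothing | _       = settle-comm-idle a b found-a
... | just _  | nothing = sym (settle-comm-idle b a found-b)
... | just qa | just qb with qa Fin.≟ qb
...   | yes refl = begin
  settle a (settle b S)  ≡⟨ cong (settle a) (settle-hit found-b) ⟩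
  settle a (S - qa)      ≡⟨ settle-cong (trans (first-after-hit a found-a) (sym (first-after-hit b found-b))) ⟩
  settle b (S - qa)      ≡⟨ cong (settle b) (sym (settle-hit found-a)) ⟩
  settle b (settle a S)  ∎
  where open ≡-Reasoning
...   | no qa≢qb = begin
  settle a (settle b S)  ≡⟨ cong (settle a) (settle-hit found-b) ⟩
  settle a (S - qb)      ≡⟨ settle-hit (first-survives found-a qa≢qb) ⟩
  S - qb - qa            ≡⟨ p─q─r≡p─r─q S ⁅ qb ⁆ ⁅ qa ⁆ ⟩
  S - qa - qb            ≡⟨ sym (settle-hit (first-survives found-b (qa≢qb ∘ sym))) ⟩
  settle b (S - qa)      ≡⟨ cong (settle b) (sym (settle-hit found-a)) ⟩
  settle b (settle a S)  ∎
  where open ≡-Reasoning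

-- The free spots left after parking a list of cars (the last car parks first, as in park).
freeAfter : ∀ {n} → List (Fin n) → Subset n → Subset n
freeAfter []       O = O
freeAfter (e ∷ es) O = settle e (freeAfter es O)

park-free : ∀ {n k} (E : Vec (Fin n) k) (O : Subset n) → proj₂ (park E O) ≡ freeAfter (toList E) O
park-free []       O = refl
park-free (e ∷ es) O with park es O | park-free es O
... | _ , O' | ih = cong (settle e) ih

freeAfter-↭ : ∀ {m} {xs ys : List (Fin (suc m))} → xs ↭ ys → ∀ O → freeAfter xs O ≡ freeAfter ys O
freeAfter-↭ ↭.refl            O = refl
freeAfter-↭ (prep e xs↭ys)    O = cong (settle e) (freeAfter-↭ xs↭ys O)
freeAfter-↭ (swap a b xs↭ys)  O =
  trans (cong (settle a ∘ settle b) (freeAfter-↭ xs↭ys O)) (settle-comm a b _)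
freeAfter-↭ (↭.trans p q)     O = trans (freeAfter-↭ p O) (freeAfter-↭ q O)

-- Rotation equivariance: the set c^s O, and parking commutes with c^s.

eqB-refl : ∀ {n} (x : Fin n) → eqB x x ≡ true
eqB-refl x with x Fin.≟ x
... | yes _   = refl
... | no x≢x  = contradiction refl x≢x

eqB-true⇒≡ : ∀ {n} {x y : Fin n} → eqB x y ≡ true → x ≡ y
eqB-true⇒≡ {x = x} {y} eq with x Fin.≟ y
... | yes x≡y = x≡y

if-true : ∀ {b e : Bool} → (if b then e else false) ≡ true → b ≡ true × e ≡ true
if-true {true} e≡true = refl , e≡true

anyL-true⁺ : ∀ {n} (p : Fin n → Bool) {x xs} → x ∈ₗ xs → p x ≡ true → anyL p xs ≡ true
anyL-true⁺ p (ListAny.here refl) px rewrite px = refl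
anyL-true⁺ p {xs = y ∷ _} (ListAny.there x∈xs) px with p y
... | true  = refl
... | false = anyL-true⁺ p x∈xs px

anyL-true⁻ : ∀ {n} (p : Fin n → Bool) xs → anyL p xs ≡ true → ∃ λ x → p x ≡ true
anyL-true⁻ p (x ∷ xs) any with p x in px
... | true  = x , px
... | false = anyL-true⁻ p xs any

∈-allFinL : ∀ {n} (x : Fin n) → x ∈ₗ allFinL n
∈-allFinL zero    = ListAny.here refl
∈-allFinL (suc x) = ListAny.there (∈-map⁺ suc (∈-allFinL x))

∈-cpowSet⁺ : ∀ {n} s {O : Subset n} {x} → x ∈ O → cpow s x ∈ cpowSet s O
∈-cpowSet⁺ {n} s {O} {x} x∈O = lookup-true⇒∈ (trans (lookup∘tabulate _ (cpow s x))
  (anyL-true⁺ _ (∈-allFinL x) (subst (λ b → (if b then _ else false) ≡ true) (sym ([]=⇒lookup x∈O))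
                                     (eqB-refl (cpow s x)))))

∈-cpowSet⁻ : ∀ {n} s {O : Subset n} {y} → y ∈ cpowSet s O → ∃ λ x → x ∈ O × cpow s x ≡ y
∈-cpowSet⁻ {n} s {O} {y} y∈ with anyL-true⁻ _ (allFinL n) (trans (sym (lookup∘tabulate _ y)) ([]=⇒lookup y∈))
... | x , hit with if-true {lookup O x} hit
...   | x∈O , fx≡y = x , lookup-true⇒∈ x∈O , eqB-true⇒≡ fx≡y

module Rotation {m} (s t : ℕ) (s+t≡n : s + t ≡ suc m) where

  private
    f g : Fin (suc m) → Fin (suc m)
    f = cpow s
    g = cpow t

    f∘g : ∀ y → f (g y) ≡ y
    f∘g = cpow-inverse s t s+t≡n

    g∘f : ∀ x → g (f x) ≡ x
    g∘f = cpow-inverse t s (trans (+-comm t s) s+t≡n)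

  ∈-rotate⁻ : ∀ {O y} → y ∈ cpowSet s O → g y ∈ O
  ∈-rotate⁻ y∈ with ∈-cpowSet⁻ s y∈
  ... | x , x∈O , refl = subst (_∈ _) (sym (g∘f x)) x∈O

  ∈-rotate⁺ : ∀ {O y} → g y ∈ O → y ∈ cpowSet s O
  ∈-rotate⁺ {y = y} gy∈O = subst (_∈ _) (f∘g y) (∈-cpowSet⁺ s gy∈O)

  cpowSet-minus : ∀ O p → cpowSet s (O - p) ≡ cpowSet s O - f p
  cpowSet-minus O p = ⊆-antisym forward backward
    where
    forward : cpowSet s (O - p) ⊆ cpowSet s O - f p
    forward y∈ with ∈-minus⁻ {O = O} (∈-rotate⁻ y∈)
    ... | gy∈O , gy≢p = ∈-minus⁺ (∈-rotate⁺ gy∈O) (λ { refl → gy≢p (g∘f p) })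
    backward : cpowSet s O - f p ⊆ cpowSet s (O - p)
    backward {y} y∈ with ∈-minus⁻ {O = cpowSet s O} y∈
    ... | y∈fO , y≢fp = ∈-rotate⁺ (∈-minus⁺ (∈-rotate⁻ {O = O} y∈fO) (λ gy≡p → y≢fp (trans (sym (f∘g y)) (cong f gy≡p))))

  orbit-rotate : ∀ e → orbit (f e) ≡ map f (orbit e)
  orbit-rotate e = trans (applyUpTo-cong (λ j → cpow-comm (suc j) s e) (suc m))
                         (sym (map-applyUpTo (walk e) f (suc m)))

  nextFree-rotate : ∀ e O → nextFree (f e) (cpowSet s O) ≡ f (nextFree e O)
  nextFree-rotate e O = begin
    nextFree (f e) (cpowSet s O)                            ≡⟨ nextFree-first (f e) (cpowSet s O) ⟩
    fromMaybe (f e) (firstIn (orbit (f e)) (cpowSet s O))   ≡⟨ cong (λ xs → fromMaybe (f e) (firstIn xs (cpowSet s O))) (orbit-rotate e) ⟩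
    fromMaybe (f e) (firstIn (map f (orbit e)) (cpowSet s O))
                                                            ≡⟨ cong (fromMaybe (f e)) search-rotate ⟩
    fromMaybe (f e) (Maybe.map f (first e O))               ≡⟨ fromMaybe-map (first e O) ⟩
    f (fromMaybe e (first e O))                             ≡⟨ cong f (sym (nextFree-first e O)) ⟩
    f (nextFree e O)                                        ∎
    where
    open ≡-Reasoning
    search-rotate : firstIn (map f (orbit e)) (cpowSet s O) ≡ Maybe.map f (first e O)
    search-rotate = firstIn-map f (∈-cpowSet⁺ s) (λ {x} fx∈ → subst (_∈ O) (g∘f x) (∈-rotate⁻ fx∈)) (orbit e)
    fromMaybe-map : ∀ w → fromMaybe (f e) (Maybe.map f w) ≡ f (fromMaybe e w)
    fromMaybe-map (just _) = refl
    fromMaybe-map nothing  = refl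

  freeAfter-rotate : ∀ L O → cpowSet s (freeAfter L O) ≡ freeAfter (map f L) (cpowSet s O)
  freeAfter-rotate []      O = refl
  freeAfter-rotate (e ∷ L) O = begin
    cpowSet s (settle e O')                  ≡⟨ cpowSet-minus O' (nextFree e O') ⟩
    cpowSet s O' - f (nextFree e O')         ≡⟨ cong (cpowSet s O' -_) (sym (nextFree-rotate e O')) ⟩
    settle (f e) (cpowSet s O')              ≡⟨ cong (settle (f e)) (freeAfter-rotate L O) ⟩
    settle (f e) (freeAfter (map f L) (cpowSet s O)) ∎
    where
    open ≡-Reasoning
    O' = freeAfter L O

-- No wrap-around while spot 0 is free.

cpow-advances : ∀ {m} (e : Fin (suc m)) {d} → d ℕ.< m ∸ toℕ e → e < cpow (suc d) e
cpow-advances {m} e {d} d<z = subst (toℕ e ℕ.<_) (sym (toℕ-cpow (suc d) e e+d<n)) (m<m+n (toℕ e) z<s)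
  where
  e+d<n : toℕ e + suc d ℕ.< suc m
  e+d<n = s<s (ℕ.≤-trans (+-monoʳ-≤ (toℕ e) d<z) (ℕ.≤-reflexive (m+[n∸m]≡n (toℕ≤pred[n] e))))

-- If spot 0 is free, a car preferring e parks strictly after e unless it takes spot 0:
-- its search meets spot 0 after m − e + 1 steps, so any other spot comes earlier.
nextFree-advances : ∀ {m} {e : Fin (suc m)} {O} → zero ∈ O → nextFree e O ≢ zero → e < nextFree e O
nextFree-advances {m} {e} {O} 0∈O p≢0 with first e O in found
... | nothing = contradiction (subst (_∈ O) (sym (cpow-wrap e)) 0∈O)
                              (applyUpTo⁻ (walk e) (suc m) (firstIn-none (orbit e) found) z<n)
  where
  z<n : m ∸ toℕ e ℕ.< suc m
  z<n = s<s (ℕ.m∸n≤m m (toℕ e))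
... | just q with firstIn-applyUpTo (walk e) (suc m) found
...   | d , _ , refl , before with <-cmp d (m ∸ toℕ e)
...     | tri< d<z _ _ = subst (e <_) (sym (nextFree-hit found)) (cpow-advances e d<z)
...     | tri≈ _ refl _ = contradiction (trans (nextFree-hit found) (cpow-wrap e)) p≢0
...     | tri> _ _ z<d = contradiction (subst (_∈ O) (sym (cpow-wrap e)) 0∈O)
                                     (applyUpTo⁻ (walk e) d before z<d)

no-wrap : ∀ {m k} (E : Vec (Fin (suc m)) k) O → zero ∈ proj₂ (park E O) → ∀ l → lookup E l < lookup (Π E O) l
no-wrap (e ∷ es) O 0∈free l with park es O | no-wrap es O
... | _ , O' | ih with ∈-minus⁻ {O = O'} 0∈free | l
...   | 0∈O' , 0≢p | zero   = nextFree-advances 0∈O' (0≢p ∘ sym)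
...   | 0∈O' , _   | suc l' = ih 0∈O' l'

residue-free : ∀ {n k} (E : Vec (Fin n) k) {O r} → r ∈ O → ¬ (r ∈ᵥ Π E O) → r ∈ proj₂ (park E O)
residue-free []       r∈O _   = r∈O
residue-free (e ∷ es) {O} r∈O r∉Π with park es O | residue-free es {O} r∈O
... | _ , _ | ih = ∈-minus⁺ (ih (r∉Π ∘ VecAny.there)) (r∉Π ∘ VecAny.here)

lemma5p2 : (n k : ℕ) (A : Vec (Fin n) k) (B : Subset n) → ∣ B ∣ ≡ suc k →
    (ρ : Fin n) → IsResidue A B ρ →
    (I : Vec (Fin n) k) →
    Sorted (≤-totalOrder n) (toList I) →
    toList I ↭ toList (cpowSeq (expOneMinus ρ) A) →
    (l : Fin k) → lookup I l < lookup (Π I (cpowSet (expOneMinus ρ) B)) l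
lemma5p2 zero    _ _ _ _ () _
lemma5p2 (suc m) _ A B _ ρ (ρ∈B , ρ∉ΠAB) I _ I↭Ã = no-wrap I B̃ 0-free
  where
  open ≡-Reasoning
  s  = expOneMinus ρ
  B̃ = cpowSet s B
  open Rotation s (toℕ ρ) (m∸n+n≡m (toℕ≤n ρ))
  ρ↦0 : cpow s ρ ≡ zero
  ρ↦0 = trans (cong (λ e → cpow e ρ) (+-∸-assoc 1 (toℕ≤pred[n] ρ))) (cpow-wrap ρ)
  free-after-I : proj₂ (park I B̃) ≡ cpowSet s (proj₂ (park A B))
  free-after-I = begin
    proj₂ (park I B̃)                      ≡⟨ park-free I B̃ ⟩
    freeAfter (toList I) B̃                ≡⟨ freeAfter-↭ I↭Ã B̃ ⟩
    freeAfter (toList (cpowSeq s A)) B̃    ≡⟨ cong (λ xs → freeAfter xs B̃) (toList-map (cpow s) A) ⟩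
    freeAfter (map (cpow s) (toList A)) B̃ ≡⟨ sym (freeAfter-rotate (toList A) B) ⟩
    cpowSet s (freeAfter (toList A) B)     ≡⟨ cong (cpowSet s) (sym (park-free A B)) ⟩
    cpowSet s (proj₂ (park A B))           ∎
  0-free : zero ∈ proj₂ (park I B̃)
  0-free = subst (zero ∈_) (sym free-after-I)
                 (subst (_∈ cpowSet s (proj₂ (park A B))) ρ↦0 (∈-cpowSet⁺ s (residue-free A ρ∈B ρ∉ΠAB)))
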